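{- Let $G$ be a directed graph, $k$ a positive integer, and $H$ a subgraph of $G$. Then $H$ is an (all-pairs) $k$-connectivity preserver of $G$, i.e. $\lambda^k_H(s,t)=\lambda^k_G(s,t)$ for all $s,t\in V(G)$, if and only if for every $s,t\in V(G)$ and every minimal symmetric $(s,t)$-cut $(S,V-S)$ in $G$ we have $|\delta^+_H(S)|\ge\lambda^k_G(s,t)$.
   Context: $V=V(G)$; a subgraph $H$ has $V(H)=V$, $E(H)\subseteq E(G)$. $\mathrm{flow}(G,s,t)$ is the maximum number of edge-disjoint $s$-to-$t$ paths; $\lambda_G(s,t)=\min(\mathrm{flow}(G,s,t),\mathrm{flow}(G,t,s))$, $\lambda^k_G(s,t)=\min(\lambda_G(s,t),k)$. For a cut $(S,V-S)$, $\delta^+_G(S)$ is the set of edges of $G$ from $S$ to $V-S$. An $(s,t)$-cut has $s\in S$, $t\in V-S$. An $(s,t)$-cut $(S,V-S)$ in $G$ is a minimal symmetric $(s,t)$-cut if there is no cut $(S',V-S')$ with $\delta^+_G(S')\subsetneq\delta^+_G(S)$ that is an $(s,t)$-cut or a $(t,s)$-cut. -}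

module Defs where

open import Data.Nat using (ℕ; _≤_)
open import Data.Fin using (Fin)
open import Data.Fin.Subset using (Subset; _∈_; _∉_; _⊂_; ∣_∣)
open import Data.Bool using (Bool; _∧_; not)
open import Data.Vec using (Vec; lookup; tabulate)
open import Data.List using (List; []; _∷_)
import Data.List.Membership.Propositional as LM
open import Data.List.Relation.Unary.Unique.Propositional using (Unique)
open import Data.Product using (Σ; _×_; proj₁; proj₂)
open import Data.Sum using (_⊎_)
open import Relation.Binary.PropositionalEquality using (_≡_; _≢_)
open import Relation.Nullary using (¬_)

-- A directed (multi)graph on vertex set Fin n with m edges, indexed by Fin m;
-- edge e goes from tail (proj₁ (G e)) to head (proj₂ (G e)).
Graph : ℕ → ℕ → Set
Graph n m = Fin m → Fin n × Fin n

module _ {n m : ℕ} (G : Graph n m) where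

  tl hd : Fin m → Fin n
  tl e = proj₁ (G e)
  hd e = proj₂ (G e)

  -- A subgraph H (with V(H) = V) is given by its edge set X ⊆ E(G).
  -- The whole graph G corresponds to the full edge set.

  data Walk (X : Subset m) : Fin n → Fin n → Set where
    nil  : ∀ {u : Fin n} → Walk X u u
    cons : ∀ {w : Fin n} (e : Fin m) → e ∈ X → Walk X (hd e) w → Walk X (tl e) w

  walkEdges : ∀ {X u w} → Walk X u w → List (Fin m)
  walkEdges nil = []
  walkEdges (cons e _ p) = e ∷ walkEdges p

  walkVerts : ∀ {X u w} → Walk X u w → List (Fin n)
  walkVerts {u = u} nil = u ∷ []
  walkVerts (cons e _ p) = tl e ∷ walkVerts p

  record Path (X : Subset m) (s t : Fin n) : Set where
    constructor path
    field
      walk   : Walk X s t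
      simple : Unique (walkVerts walk)
  open Path public

  EdgeDisjoint : ∀ {X s t} → Path X s t → Path X s t → Set
  EdgeDisjoint p q = ∀ e → e LM.∈ walkEdges (walk p) → ¬ (e LM.∈ walkEdges (walk q))

  HasFlow : Subset m → Fin n → Fin n → ℕ → Set
  HasFlow X s t j = Σ (Fin j → Path X s t) λ P →
    ∀ i i' → i ≢ i' → EdgeDisjoint (P i) (P i')

  -- c = λ^k_X(s,t) = min(flow(X,s,t), flow(X,t,s), k), i.e. c is the largest
  -- j ≤ k with j ≤ flow(X,s,t) and j ≤ flow(X,t,s).  (Well-defined also when a
  -- flow is infinite, e.g. s = t.)
  IsLamK : Subset m → ℕ → Fin n → Fin n → ℕ → Set
  IsLamK X k s t c =
    c ≤ k × HasFlow X s t c × HasFlow X t s c ×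
    (∀ j → j ≤ k → HasFlow X s t j → HasFlow X t s j → j ≤ c)

  δ⁺ : Subset m → Subset n → Subset m
  δ⁺ X S = tabulate λ e → lookup X e ∧ lookup S (tl e) ∧ not (lookup S (hd e))

  IsCut : Fin n → Fin n → Subset n → Set
  IsCut s t S = s ∈ S × t ∉ S

  IsMinSymCut : Subset m → Fin n → Fin n → Subset n → Set
  IsMinSymCut X s t S = IsCut s t S ×
    (∀ S' → δ⁺ X S' ⊂ δ⁺ X S → ¬ (IsCut s t S' ⊎ IsCut t s S'))

-- (⇒) The c = λᵏ_G(s,t) edge-disjoint s–t paths of H leave an (s,t)-cut S through
-- pairwise distinct edges of δ⁺_H(S).
-- (⇐) By Menger's theorem, if H had fewer than c edge-disjoint s–t paths, some (s,t)-cut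
-- S would have |δ⁺_H(S)| < c.  Among the (s,t)- and (t,s)-cuts S′ with δ⁺_G(S′) ⊆ δ⁺_G(S)
-- take one with δ⁺_G(S′) inclusion-minimal: it is a minimal symmetric cut and
-- δ⁺_H(S′) ⊆ δ⁺_H(S), so the hypothesis at S′ (with s and t swapped if necessary, λ being
-- symmetric) gives c ≤ |δ⁺_H(S′)| < c.
--
-- Menger's theorem is proved by augmenting paths.  Given j edge-disjoint s–t walks, either
-- t is reachable from s in the residual graph, and rerouting along a simple residual walk
-- gives j + 1 such walks, or the set S of vertices reachable from s is an (s,t)-cut whose
-- outgoing edges are all used and which no walk re-enters, so |δ⁺(S)| ≤ j.

module Submission where

open import Defs
import Algebra.Solver.CommutativeMonoid as CommutativeMonoidSolver
open import Data.Bool using (true; false; not; _∧_)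
open import Data.Bool.Properties using (¬-not; not-¬)
open import Data.Fin using (Fin; zero; suc; _≟_)
open import Data.Fin.Properties using (suc-injective; 0≢1+n; any?)
open import Data.Fin.Subset
  using (Subset; inside; outside; ⊥; ⊤; ⁅_⁆; ∁; _∪_; _⊆_; _⊂_; _-_; ∣_∣)
  renaming (_∈_ to _∈ˢ_; _∉_ to _∉ˢ_)
open import Data.Fin.Subset.Properties
  using ( _∈?_; _⊂?_; anySubset?; ∈⊤; x∈⁅x⁆; x∈⁅y⁆⇒x≡y; p⊆p∪q; x∈p∪q⁺; x∈p∪q⁻; ⊆-trans
        ; ∣⊥∣≡0; ∣p∣≤∣x∷p∣; p⊆q⇒∣p∣≤∣q∣; p⊂q⇒p⊆q; p⊂q⇒∣p∣<∣q∣; p⊂q⇒∁p⊃∁q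
        ; x∈p⇒∣p-x∣<∣p∣; x∈p∧x≢y⇒x∈p-y)
open import Data.List using (List; []; _∷_; [_]; _++_; length; foldr; concatMap; filter; lookup)
open import Data.List.Properties using (length-++; filter-++; concatMap-++)
open import Data.List.Membership.Propositional using (_∈_; _∉_; find; lose)
open import Data.List.Membership.Propositional.Properties
  using (∈-++⁺ˡ; ∈-++⁺ʳ; ∈-++⁻; ∈-∃++; ∈-concatMap⁺; ∈-concatMap⁻; ∈-filter⁺; ∈-lookup)
import Data.List.Membership.DecPropositional as DecMembership
open import Data.List.Relation.Binary.Permutation.Propositional
  using (_↭_; ↭-refl; ↭-sym; ↭⇒↭ₛ; module PermutationReasoning)
open import Data.List.Relation.Binary.Permutation.Propositional.Properties
  using (∈-resp-↭; ++-commutativeMonoid)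
import Data.List.Relation.Binary.Permutation.Setoid.Properties as SetoidPermutation
open import Data.List.Relation.Binary.Subset.Propositional using () renaming (_⊆_ to _⊆ₗ_)
open import Data.List.Relation.Unary.All as All using (All; []; _∷_)
open import Data.List.Relation.Unary.All.Properties using (¬Any⇒All¬; All¬⇒¬Any; ++⁻ˡ; ++⁻ʳ)
  renaming (++⁺ to All-++⁺)
open import Data.List.Relation.Unary.AllPairs using ([]; _∷_)
open import Data.List.Relation.Unary.Any using (here; there)
open import Data.List.Relation.Unary.Unique.Propositional using (Unique)
open import Data.List.Relation.Unary.Unique.Propositional.Properties using (++⁺)
open import Data.Nat using (ℕ; zero; suc; _≤_; _<_; z≤n; s≤s; _+_)
open import Data.Nat.Induction using (<-wellFounded)
open import Data.Nat.Properties
  using (≤-reflexive; ≤-trans; ≤-<-trans; <⇒≱; m<n⇒m<1+n; +-mono-≤; module ≤-Reasoning)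
open import Data.Product using (Σ; ∃; ∃₂; _×_; _,_; proj₁; proj₂)
import Data.Product as Product
open import Data.Sum using (_⊎_; inj₁; inj₂)
import Data.Sum as Sum
open import Data.Vec using (_∷_; _[_]≔_) renaming (lookup to lookupᵛ)
open import Data.Vec.Properties using ([]≔-updates; []≔-minimal; []=⇒lookup; lookup⇒[]=; lookup∘tabulate)
open import Function using (_∘_; id)
open import Function.Bundles using (_⇔_; mk⇔; Equivalence)
import Function.Properties.Equivalence as ⇔
open import Induction.WellFounded using (Acc; acc)
open import Relation.Binary.Construct.Closure.ReflexiveTransitive using (Star; ε; _◅_; _◅◅_)
open import Relation.Binary.PropositionalEquality
  using (_≡_; _≢_; refl; sym; trans; cong; cong₂; subst; ≢-sym; setoid; module ≡-Reasoning)
open import Relation.Nullary using (¬_; Dec; yes; no; contradiction)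
open import Relation.Nullary.Decidable using (map′; decidable-stable; _×-dec_; _⊎-dec_; ¬?)

module _ {A : Set} where

  Unique-resp-↭ : ∀ {xs ys : List A} → xs ↭ ys → Unique xs → Unique ys
  Unique-resp-↭ xs↭ys = SetoidPermutation.Unique-resp-↭ (setoid A) (↭⇒↭ₛ xs↭ys)

  Unique-++⁻ˡ : ∀ xs {ys : List A} → Unique (xs ++ ys) → Unique xs
  Unique-++⁻ˡ []       _               = []
  Unique-++⁻ˡ (x ∷ xs) (x∉ ∷ unique) = ++⁻ˡ xs x∉ ∷ Unique-++⁻ˡ xs unique

  Unique-++⁻ʳ : ∀ xs {ys : List A} → Unique (xs ++ ys) → Unique ys
  Unique-++⁻ʳ []       unique       = unique
  Unique-++⁻ʳ (x ∷ xs) (_ ∷ unique) = Unique-++⁻ʳ xs unique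

  Unique-++⇒disjoint : ∀ xs {ys : List A} {y} → Unique (xs ++ ys) → y ∈ xs → y ∉ ys
  Unique-++⇒disjoint (x ∷ xs) (x∉ ∷ _)     (here refl)  = All¬⇒¬Any (++⁻ʳ xs x∉)
  Unique-++⇒disjoint (x ∷ xs) (_ ∷ unique) (there y∈xs) = Unique-++⇒disjoint xs unique y∈xs

  ∈-tail : ∀ {x y : A} {xs} → y ≢ x → y ∈ x ∷ xs → y ∈ xs
  ∈-tail y≢x (here y≡x)  = contradiction y≡x y≢x
  ∈-tail _   (there y∈xs) = y∈xs

  data Toggle (e : A) (F : List A) : List A → Set where
    added   : ∀ {F′} → e ∉ F → F′ ↭ e ∷ F → Toggle e F F′
    removed : ∀ {F′} → e ∷ F′ ↭ F → Toggle e F F′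

  Toggle-unique : ∀ {e F F′} → Toggle e F F′ → Unique F → Unique F′
  Toggle-unique (added e∉F F′↭) unique = Unique-resp-↭ (↭-sym F′↭) (¬Any⇒All¬ _ e∉F ∷ unique)
  Toggle-unique (removed ↭F)    unique with Unique-resp-↭ (↭-sym ↭F) unique
  ... | _ ∷ unique′ = unique′

  Toggle-∈ : ∀ {e F F′ f} → Toggle e F F′ → f ≢ e → f ∈ F ⇔ f ∈ F′
  Toggle-∈ (added _ F′↭) f≢e = mk⇔ (∈-resp-↭ (↭-sym F′↭) ∘ there) (∈-tail f≢e ∘ ∈-resp-↭ F′↭)
  Toggle-∈ (removed ↭F)  f≢e = mk⇔ (∈-tail f≢e ∘ ∈-resp-↭ (↭-sym ↭F)) (∈-resp-↭ ↭F ∘ there)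

module _ {A B : Set} (f : A → List B) where

  ∈-concatMap-split : ∀ {y} xs → y ∈ concatMap f xs →
                      ∃₂ λ pre post → ∃ λ x → xs ≡ pre ++ x ∷ post × y ∈ f x
  ∈-concatMap-split xs y∈ with find (∈-concatMap⁻ f y∈)
  ... | x , x∈xs , y∈fx with ∈-∃++ x∈xs
  ...   | pre , post , xs≡ = pre , post , x , xs≡ , y∈fx

  Unique-concatMap⇒disjoint : ∀ xs → Unique (concatMap f xs) →
                              ∀ {i j y} → i ≢ j → y ∈ f (lookup xs i) → y ∉ f (lookup xs j)
  Unique-concatMap⇒disjoint (x ∷ xs) _ {zero} {zero} 0≢0 = contradiction refl 0≢0
  Unique-concatMap⇒disjoint (x ∷ xs) unique {zero} {suc j} _ y∈x y∈j =
    Unique-++⇒disjoint (f x) unique y∈x (∈-concatMap⁺ f (lose (∈-lookup {xs = xs} j) y∈j))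
  Unique-concatMap⇒disjoint (x ∷ xs) unique {suc i} {zero} _ y∈i y∈x =
    Unique-++⇒disjoint (f x) unique y∈x (∈-concatMap⁺ f (lose (∈-lookup {xs = xs} i) y∈i))
  Unique-concatMap⇒disjoint (x ∷ xs) unique {suc i} {suc j} i≢j =
    Unique-concatMap⇒disjoint xs (Unique-++⁻ʳ (f x) unique) (i≢j ∘ cong suc)

p⊆p[x]≔inside : ∀ {n} (p : Subset n) x → p ⊆ p [ x ]≔ inside
p⊆p[x]≔inside p x {y} y∈p with y ≟ x
... | yes refl = []≔-updates p x
... | no y≢x   = []≔-minimal p y x y≢x y∈p

∣p[x]≔inside∣≤1+∣p∣ : ∀ {n} (p : Subset n) x → ∣ p [ x ]≔ inside ∣ ≤ suc ∣ p ∣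
∣p[x]≔inside∣≤1+∣p∣ (b ∷ p)       zero    = s≤s (∣p∣≤∣x∷p∣ b p)
∣p[x]≔inside∣≤1+∣p∣ (inside ∷ p)  (suc x) = s≤s (∣p[x]≔inside∣≤1+∣p∣ p x)
∣p[x]≔inside∣≤1+∣p∣ (outside ∷ p) (suc x) = ∣p[x]≔inside∣≤1+∣p∣ p x

fromList : ∀ {n} → List (Fin n) → Subset n
fromList = foldr (λ x p → p [ x ]≔ inside) ⊥

∈⇒∈fromList : ∀ {n} {x : Fin n} {xs} → x ∈ xs → x ∈ˢ fromList xs
∈⇒∈fromList {xs = x ∷ xs} (here refl)  = []≔-updates (fromList xs) x
∈⇒∈fromList {xs = y ∷ xs} (there x∈xs) = p⊆p[x]≔inside (fromList xs) y (∈⇒∈fromList x∈xs)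

∣fromList∣≤length : ∀ {n} (xs : List (Fin n)) → ∣ fromList xs ∣ ≤ length xs
∣fromList∣≤length {n} []       = ≤-reflexive (∣⊥∣≡0 n)
∣fromList∣≤length     (x ∷ xs) =
  ≤-trans (∣p[x]≔inside∣≤1+∣p∣ (fromList xs) x) (s≤s (∣fromList∣≤length xs))

∣p∣≤length : ∀ {n} {p : Subset n} xs → (∀ {x} → x ∈ˢ p → x ∈ xs) → ∣ p ∣ ≤ length xs
∣p∣≤length xs p⊆xs = ≤-trans (p⊆q⇒∣p∣≤∣q∣ (∈⇒∈fromList ∘ p⊆xs)) (∣fromList∣≤length xs)

injective⇒≤∣p∣ : ∀ {c n} {p : Subset n} (f : Fin c → Fin n) →
                 (∀ {i j} → f i ≡ f j → i ≡ j) → (∀ i → f i ∈ˢ p) → c ≤ ∣ p ∣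
injective⇒≤∣p∣ {zero}  f _   _   = z≤n
injective⇒≤∣p∣ {suc c} {p = p} f inj f∈p = ≤-trans (s≤s f∘suc-bound) (x∈p⇒∣p-x∣<∣p∣ (f∈p zero))
  where
  f∘suc-bound : c ≤ ∣ p - f zero ∣
  f∘suc-bound = injective⇒≤∣p∣ (f ∘ suc) (suc-injective ∘ inj)
                  (λ i → x∈p∧x≢y⇒x∈p-y (f∈p (suc i)) (0≢1+n ∘ sym ∘ inj))

minimal-below : ∀ {n m ℓ} {P : Subset n → Set ℓ} → (∀ S → Dec (P S)) →
                (D : Subset n → Subset m) → ∀ {S} → P S →
                ∃ λ S′ → P S′ × D S′ ⊆ D S × (∀ S″ → D S″ ⊂ D S′ → ¬ P S″)
minimal-below {P = P} P? D {S} PS = descend S (<-wellFounded _) PS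
  where
  descend : ∀ S → Acc _<_ ∣ D S ∣ → P S → ∃ λ S′ → P S′ × D S′ ⊆ D S × (∀ S″ → D S″ ⊂ D S′ → ¬ P S″)
  descend S (acc smaller) PS with anySubset? (λ S′ → (D S′ ⊂? D S) ×-dec P? S′)
  ... | no  none = S , PS , id , λ S′ D′⊂D PS′ → none (S′ , D′⊂D , PS′)
  ... | yes (S′ , D′⊂D , PS′) =
    let S″ , PS″ , D″⊆D′ , minimal = descend S′ (smaller (p⊂q⇒∣p∣<∣q∣ D′⊂D)) PS′
    in S″ , PS″ , ⊆-trans D″⊆D′ (p⊂q⇒p⊆q D′⊂D) , minimal

module _ {n m : ℕ} (G : Graph n m) {X : Subset m} {S : Subset n} where

  ∈δ⁺⁺ : ∀ {e} → e ∈ˢ X → tl G e ∈ˢ S → hd G e ∉ˢ S → e ∈ˢ δ⁺ G X S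
  ∈δ⁺⁺ {e} e∈X tl∈S hd∉S = lookup⇒[]= e _ (begin
    lookupᵛ (δ⁺ G X S) e
      ≡⟨ lookup∘tabulate _ e ⟩
    lookupᵛ X e ∧ lookupᵛ S (tl G e) ∧ not (lookupᵛ S (hd G e))
      ≡⟨ cong₂ _∧_ ([]=⇒lookup e∈X) (cong₂ _∧_ ([]=⇒lookup tl∈S) (cong not hd∉S′)) ⟩
    true ∎)
    where
    open ≡-Reasoning
    hd∉S′ : lookupᵛ S (hd G e) ≡ false
    hd∉S′ = ¬-not (hd∉S ∘ lookup⇒[]= (hd G e) S)

  ∈δ⁺⁻ : ∀ {e} → e ∈ˢ δ⁺ G X S → e ∈ˢ X × tl G e ∈ˢ S × hd G e ∉ˢ S
  ∈δ⁺⁻ {e} e∈δ⁺ with lookupᵛ X e in eX | lookupᵛ S (tl G e) in eT | lookupᵛ S (hd G e) in eH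
                   | trans (sym (lookup∘tabulate _ e)) ([]=⇒lookup e∈δ⁺)
  ... | true  | true  | false | _ =
        lookup⇒[]= e X eX , lookup⇒[]= (tl G e) S eT , λ hd∈S → not-¬ eH ([]=⇒lookup hd∈S)
  ... | false | _     | _     | ()
  ... | true  | false | _     | ()
  ... | true  | true  | true  | ()

δ⁺-restrict : ∀ {n m} (G : Graph n m) {X Y : Subset m} {S S′ : Subset n} →
              Y ⊆ X → δ⁺ G X S′ ⊆ δ⁺ G X S → δ⁺ G Y S′ ⊆ δ⁺ G Y S
δ⁺-restrict G {X} {Y} {S} {S′} Y⊆X δ⁺X⊆ e∈δ⁺Y =
  let e∈Y , tl∈S′ , hd∉S′ = ∈δ⁺⁻ G {Y} {S′} e∈δ⁺Y
      _   , tl∈S  , hd∉S  = ∈δ⁺⁻ G {X} {S} (δ⁺X⊆ (∈δ⁺⁺ G (Y⊆X e∈Y) tl∈S′ hd∉S′))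
  in ∈δ⁺⁺ G e∈Y tl∈S hd∉S

module Walks {n m : ℕ} (G : Graph n m) {X : Subset m} where

  open DecMembership (_≟_ {n}) using () renaming (_∈?_ to _∈ᵛ?_)

  infixr 5 _++ʷ_
  _++ʷ_ : ∀ {a b c} → Walk G X a b → Walk G X b c → Walk G X a c
  nil          ++ʷ q = q
  cons e e∈X p ++ʷ q = cons e e∈X (p ++ʷ q)

  walkEdges-++ʷ : ∀ {a b c} (p : Walk G X a b) (q : Walk G X b c) →
                  walkEdges G (p ++ʷ q) ≡ walkEdges G p ++ walkEdges G q
  walkEdges-++ʷ nil          q = refl
  walkEdges-++ʷ (cons e _ p) q = cong (e ∷_) (walkEdges-++ʷ p q)

  split-at : ∀ {a b e} (w : Walk G X a b) → e ∈ walkEdges G w →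
             Σ (Walk G X a (tl G e)) λ p → Σ (Walk G X (hd G e) b) λ q →
               walkEdges G w ≡ walkEdges G p ++ e ∷ walkEdges G q
  split-at (cons _ _ w)   (here refl)  = nil , w , refl
  split-at (cons f f∈X w) (there e∈w) =
    let p , q , w≡peq = split-at w e∈w in cons f f∈X p , q , cong (f ∷_) w≡peq

  suffix : ∀ {a b v} (w : Walk G X a b) → v ∈ walkVerts G w →
           Σ (Walk G X v b) λ q →
             (Unique (walkVerts G w) → Unique (walkVerts G q)) × walkEdges G q ⊆ₗ walkEdges G w
  suffix nil            (here refl) = nil , id , λ ()
  suffix (cons e e∈X w) (here refl) = cons e e∈X w , id , id
  suffix (cons e _ w)   (there v∈w) =
    let q , unique , q⊆w = suffix w v∈w
    in q , (λ { (_ ∷ w-simple) → unique w-simple }) , there ∘ q⊆w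

  shortcut : ∀ {a b} (w : Walk G X a b) →
             Σ (Path G X a b) λ p → walkEdges G (walk p) ⊆ₗ walkEdges G w
  shortcut nil = path nil ([] ∷ []) , λ ()
  shortcut (cons e e∈X w) with shortcut w
  ... | path p p-simple , p⊆w with tl G e ∈ᵛ? walkVerts G p
  ...   | yes tl∈p = let q , unique , q⊆p = suffix p tl∈p
                     in path q (unique p-simple) , there ∘ p⊆w ∘ q⊆p
  ...   | no  tl∉p = path (cons e e∈X p) (¬Any⇒All¬ _ tl∉p ∷ p-simple) ,
                     λ { (here refl) → here refl ; (there f∈p) → there (p⊆w f∈p) }

  exit-edge : ∀ {S a b} (w : Walk G X a b) → a ∈ˢ S → b ∉ˢ S →
              ∃ λ e → e ∈ walkEdges G w × e ∈ˢ δ⁺ G X S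
  exit-edge nil                  a∈S a∉S = contradiction a∈S a∉S
  exit-edge {S} (cons e e∈X w) tl∈S b∉S with hd G e ∈? S
  ... | yes hd∈S = let f , f∈w , f∈δ⁺ = exit-edge w hd∈S b∉S in f , there f∈w , f∈δ⁺
  ... | no  hd∉S = e , here refl , ∈δ⁺⁺ G e∈X tl∈S hd∉S

  flow≤cut : ∀ {s t S c} → HasFlow G X s t c → IsCut G s t S → c ≤ ∣ δ⁺ G X S ∣
  flow≤cut {S = S} (P , disjoint) (s∈S , t∉S) =
    injective⇒≤∣p∣ (proj₁ ∘ exit) injective (proj₂ ∘ proj₂ ∘ exit)
    where
    exit : ∀ i → ∃ λ e → e ∈ walkEdges G (walk (P i)) × e ∈ˢ δ⁺ G X S
    exit i = exit-edge (walk (P i)) s∈S t∉S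
    injective : ∀ {i j} → proj₁ (exit i) ≡ proj₁ (exit j) → i ≡ j
    injective {i} {j} same-exit = decidable-stable (i ≟ j) λ i≢j →
      disjoint i j i≢j _ (proj₁ (proj₂ (exit i)))
        (subst (_∈ walkEdges G (walk (P j))) (sym same-exit) (proj₁ (proj₂ (exit j))))

  walksEdges : ∀ {a b} → List (Walk G X a b) → List (Fin m)
  walksEdges = concatMap (walkEdges G)

  walks⇒flow : ∀ {s t} (ws : List (Walk G X s t)) → Unique (walksEdges ws) → HasFlow G X s t (length ws)
  walks⇒flow ws unique = proj₁ ∘ shortcut ∘ lookup ws , λ i j i≢j e e∈i e∈j →
    Unique-concatMap⇒disjoint (walkEdges G) ws unique i≢j
      (proj₂ (shortcut (lookup ws i)) e∈i) (proj₂ (shortcut (lookup ws j)) e∈j)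

  module _ {S : Subset n} where

    private
      exits : List (Fin m) → List (Fin m)
      exits = filter (_∈? δ⁺ G X S)

    NoEntry : List (Fin m) → Set
    NoEntry F = ∀ {e} → e ∈ F → hd G e ∈ˢ S → tl G e ∈ˢ S

    stays-outside : ∀ {a b} (w : Walk G X a b) → NoEntry (walkEdges G w) → a ∉ˢ S →
                    length (exits (walkEdges G w)) ≡ 0
    stays-outside nil          _        _    = refl
    stays-outside (cons e _ w) no-entry tl∉S with e ∈? δ⁺ G X S
    ... | yes e∈δ⁺ = contradiction (proj₁ (proj₂ (∈δ⁺⁻ G {X} {S} e∈δ⁺))) tl∉S
    ... | no  _    = stays-outside w (no-entry ∘ there) (tl∉S ∘ no-entry (here refl))

    exits-once : ∀ {a b} (w : Walk G X a b) → NoEntry (walkEdges G w) → length (exits (walkEdges G w)) ≤ 1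
    exits-once nil          _        = z≤n
    exits-once (cons e _ w) no-entry with e ∈? δ⁺ G X S
    ... | yes e∈δ⁺ =
      s≤s (≤-reflexive (stays-outside w (no-entry ∘ there) (proj₂ (proj₂ (∈δ⁺⁻ G {X} {S} e∈δ⁺)))))
    ... | no  _    = exits-once w (no-entry ∘ there)

    count-exits : ∀ {a b} (ws : List (Walk G X a b)) → NoEntry (walksEdges ws) →
                  length (exits (walksEdges ws)) ≤ length ws
    count-exits []       _        = z≤n
    count-exits (w ∷ ws) no-entry = begin
      length (exits (walkEdges G w ++ walksEdges ws))            ≡⟨ cong length (filter-++ _ (walkEdges G w) _) ⟩
      length (exits (walkEdges G w) ++ exits (walksEdges ws))    ≡⟨ length-++ (exits (walkEdges G w)) ⟩
      length (exits (walkEdges G w)) + length (exits (walksEdges ws))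
        ≤⟨ +-mono-≤ (exits-once w (no-entry ∘ ∈-++⁺ˡ)) (count-exits ws (no-entry ∘ ∈-++⁺ʳ _)) ⟩
      suc (length ws)                                             ∎
      where open ≤-Reasoning

  widen : ∀ {Y a b} → X ⊆ Y → Walk G X a b → Walk G Y a b
  widen X⊆Y nil            = nil
  widen X⊆Y (cons e e∈X w) = cons e (X⊆Y e∈X) (widen X⊆Y w)

  walkEdges-widen : ∀ {Y a b} (X⊆Y : X ⊆ Y) (w : Walk G X a b) →
                    walkEdges G (widen X⊆Y w) ≡ walkEdges G w
  walkEdges-widen X⊆Y nil          = refl
  walkEdges-widen X⊆Y (cons e _ w) = cong (e ∷_) (walkEdges-widen X⊆Y w)

  walkVerts-widen : ∀ {Y a b} (X⊆Y : X ⊆ Y) (w : Walk G X a b) →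
                    walkVerts G (widen X⊆Y w) ≡ walkVerts G w
  walkVerts-widen X⊆Y nil          = refl
  walkVerts-widen X⊆Y (cons e _ w) = cong (tl G e ∷_) (walkVerts-widen X⊆Y w)

  HasFlow-mono : ∀ {Y s t j} → X ⊆ Y → HasFlow G X s t j → HasFlow G Y s t j
  HasFlow-mono {Y} X⊆Y (P , disjoint) = widen-path ∘ P , λ i j i≢j e e∈i e∈j →
    disjoint i j i≢j e (subst (e ∈_) (walkEdges-widen X⊆Y (walk (P i))) e∈i)
                       (subst (e ∈_) (walkEdges-widen X⊆Y (walk (P j))) e∈j)
    where
    widen-path : ∀ {s t} → Path G X s t → Path G Y s t
    widen-path (path w w-simple) = path (widen X⊆Y w) (subst Unique (sym (walkVerts-widen X⊆Y w)) w-simple)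

module _ {n ℓ} {T : Fin n → Fin n → Set ℓ} where

  vertices : ∀ {u v} → Star T u v → List (Fin n)
  vertices {u} ε       = u ∷ []
  vertices {u} (_ ◅ q) = u ∷ vertices q

  head∈vertices : ∀ {u v} (q : Star T u v) → u ∈ vertices q
  head∈vertices ε       = here refl
  head∈vertices (_ ◅ _) = here refl

  vertices-◅◅-step : ∀ {u v w} (q : Star T u v) (step : T v w) → vertices (q ◅◅ step ◅ ε) ≡ vertices q ++ [ w ]
  vertices-◅◅-step ε        _    = refl
  vertices-◅◅-step (_ ◅ q) step = cong (_ ∷_) (vertices-◅◅-step q step)

  Closed : Subset n → Set ℓ
  Closed S = ∀ {u v} → u ∈ˢ S → T u v → v ∈ˢ S

  SimpleWalk : Fin n → Fin n → Set ℓ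
  SimpleWalk u v = Σ (Star T u v) (Unique ∘ vertices)

  simple-walk-or-closed : (∀ u v → Dec (T u v)) → ∀ s t →
                          SimpleWalk s t ⊎ ∃ λ S → s ∈ˢ S × t ∉ˢ S × Closed S
  simple-walk-or-closed T? s t = search ⁅ s ⁆ (<-wellFounded _) (x∈⁅x⁆ s) root
    where
    Tree : Subset n → Set ℓ
    Tree S = ∀ {v} → v ∈ˢ S → Σ (SimpleWalk s v) λ (q , _) → All (_∈ˢ S) (vertices q)

    root : Tree ⁅ s ⁆
    root v∈⁅s⁆ with refl ← x∈⁅y⁆⇒x≡y s v∈⁅s⁆ = (ε , [] ∷ []) , x∈⁅x⁆ s ∷ []

    search : ∀ S → Acc _<_ ∣ ∁ S ∣ → s ∈ˢ S → Tree S → SimpleWalk s t ⊎ ∃ λ S → s ∈ˢ S × t ∉ˢ S × Closed S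
    search S (acc smaller) s∈S tree with t ∈? S
    ... | yes t∈S = inj₁ (proj₁ (tree t∈S))
    ... | no  t∉S with any? (λ u → any? λ v → (u ∈? S) ×-dec ¬? (v ∈? S) ×-dec T? u v)
    ...   | no no-exit = inj₂ (S , s∈S , t∉S , λ {u} {v} u∈S uTv →
                           decidable-stable (v ∈? S) λ v∉S → no-exit (u , v , u∈S , v∉S , uTv))
    ...   | yes (u , v , u∈S , v∉S , uTv) =
      search S′ (smaller (p⊂q⇒∣p∣<∣q∣ (p⊂q⇒∁p⊃∁q S⊂S′))) (p⊆p∪q _ s∈S) tree′
      where
      S′ : Subset n
      S′ = S ∪ ⁅ v ⁆
      v∈S′ : v ∈ˢ S′
      v∈S′ = x∈p∪q⁺ (inj₂ (x∈⁅x⁆ v))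
      S⊂S′ : S ⊂ S′
      S⊂S′ = p⊆p∪q _ , v , v∈S′ , v∉S
      tree′ : Tree S′
      tree′ w∈S′ with x∈p∪q⁻ S _ w∈S′
      ... | inj₁ w∈S = let (q , q-simple) , q⊆S = tree w∈S in (q , q-simple) , All.map (p⊆p∪q _) q⊆S
      ... | inj₂ w∈⁅v⁆ with refl ← x∈⁅y⁆⇒x≡y v w∈⁅v⁆ =
        let (q , q-simple) , q⊆S = tree u∈S
        in (q ◅◅ uTv ◅ ε ,
            subst Unique (sym (vertices-◅◅-step q uTv))
              (++⁺ q-simple ([] ∷ []) λ { (v∈q , here refl) → v∉S (All.lookup q⊆S v∈q) })) ,
           subst (All (_∈ˢ S′)) (sym (vertices-◅◅-step q uTv)) (All-++⁺ (All.map (p⊆p∪q _) q⊆S) (v∈S′ ∷ []))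

module Residual {n m : ℕ} (G : Graph n m) (X : Subset m) where

  open Walks G
  open DecMembership (_≟_ {m}) using () renaming (_∈?_ to _∈ᵉ?_)

  data ResStep (F : List (Fin m)) : Fin n → Fin n → Set where
    forward  : ∀ e → e ∈ˢ X → e ∉ F → ResStep F (tl G e) (hd G e)
    backward : ∀ e → e ∈ F → ResStep F (hd G e) (tl G e)

  edgeOf : ∀ {F u v} → ResStep F u v → Fin m
  edgeOf (forward e _ _) = e
  edgeOf (backward e _)  = e

  resEdges : ∀ {F u v} → Star (ResStep F) u v → List (Fin m)
  resEdges ε         = []
  resEdges (st ◅ q) = edgeOf st ∷ resEdges q

  resStep? : ∀ F u v → Dec (ResStep F u v)
  resStep? F u v = map′ arc⇒step step⇒arc (any? λ e →
    ((e ∈? X) ×-dec ¬? (e ∈ᵉ? F) ×-dec (tl G e ≟ u) ×-dec (hd G e ≟ v)) ⊎-dec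
    ((e ∈ᵉ? F) ×-dec (hd G e ≟ u) ×-dec (tl G e ≟ v)))
    where
    Arc : Fin n → Fin n → Set
    Arc u v = ∃ λ e → (e ∈ˢ X × e ∉ F × tl G e ≡ u × hd G e ≡ v) ⊎ (e ∈ F × hd G e ≡ u × tl G e ≡ v)
    arc⇒step : ∀ {u v} → Arc u v → ResStep F u v
    arc⇒step (e , inj₁ (e∈X , e∉F , refl , refl)) = forward e e∈X e∉F
    arc⇒step (e , inj₂ (e∈F , refl , refl))       = backward e e∈F
    step⇒arc : ∀ {u v} → ResStep F u v → Arc u v
    step⇒arc (forward e e∈X e∉F) = e , inj₁ (e∈X , e∉F , refl , refl)
    step⇒arc (backward e e∈F)    = e , inj₂ (e∈F , refl , refl)

  endpoints∈vertices : ∀ {F u v} (q : Star (ResStep F) u v) {e} → e ∈ resEdges q →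
                       tl G e ∈ vertices q × hd G e ∈ vertices q
  endpoints∈vertices (forward _ _ _ ◅ q) (here refl) = here refl , there (head∈vertices q)
  endpoints∈vertices (backward _ _ ◅ q)  (here refl) = there (head∈vertices q) , here refl
  endpoints∈vertices (_ ◅ q)             (there e∈q) = Product.map there there (endpoints∈vertices q e∈q)

  simple⇒edge-unique : ∀ {F u v} (q : Star (ResStep F) u v) → Unique (vertices q) → Unique (resEdges q)
  simple⇒edge-unique ε _ = []
  simple⇒edge-unique (forward e _ _ ◅ q) (tl∉q ∷ q-simple) =
    All.tabulate (λ { f∈q refl → All¬⇒¬Any tl∉q (proj₁ (endpoints∈vertices q f∈q)) }) ∷
    simple⇒edge-unique q q-simple
  simple⇒edge-unique (backward e _ ◅ q) (hd∉q ∷ q-simple) =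
    All.tabulate (λ { f∈q refl → All¬⇒¬Any hd∉q (proj₂ (endpoints∈vertices q f∈q)) }) ∷
    simple⇒edge-unique q q-simple

  cut-bound : ∀ {a b S} (ws : List (Walk G X a b)) → Closed {T = ResStep (walksEdges ws)} S →
              ∣ δ⁺ G X S ∣ ≤ length ws
  cut-bound {S = S} ws closed =
    ≤-trans (∣p∣≤length _ exit∈exits) (count-exits ws λ {e} e∈ws hd∈S → closed hd∈S (backward e e∈ws))
    where
    exit∈exits : ∀ {e} → e ∈ˢ δ⁺ G X S → e ∈ filter (_∈? δ⁺ G X S) (walksEdges ws)
    exit∈exits {e} e∈δ⁺ with e ∈ᵉ? walksEdges ws
    ... | yes e∈ws = ∈-filter⁺ _ e∈ws e∈δ⁺
    ... | no  e∉ws = let e∈X , tl∈S , hd∉S = ∈δ⁺⁻ G {X} {S} e∈δ⁺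
                     in contradiction (closed tl∈S (forward e e∈X e∉ws)) hd∉S

module Menger {n m : ℕ} (G : Graph n m) (X : Subset m) (s t : Fin n) where

  open Walks G
  open Residual G X

  open CommutativeMonoidSolver (++-commutativeMonoid {A = Fin m}) using (solve; _⊜_; _⊕_)
  open PermutationReasoning

  -- A backward step over an edge of the front cuts a loop off it; loops are kept because
  -- later backward steps may run over their edges.
  Loop : Set
  Loop = ∃ λ y → Walk G X y y

  record Routing (x : Fin n) : Set where
    constructor routing
    field
      routes : List (Walk G X s t)
      front  : Walk G X s x
      loops  : List Loop
  open Routing

  loopsEdges : List Loop → List (Fin m)
  loopsEdges = concatMap (walkEdges G ∘ proj₂)

  -- In this order, edges (routing ws nil []) reduces to walksEdges ws.
  edges : ∀ {x} → Routing x → List (Fin m)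
  edges (routing ws p cs) = walkEdges G p ++ loopsEdges cs ++ walksEdges ws

  Toggled : ∀ {x} → Routing x → Fin m → Fin n → Set
  Toggled σ e y = Σ (Routing y) λ σ′ →
    length (routes σ′) ≡ length (routes σ) × Toggle e (edges σ) (edges σ′)

  extend : ∀ {e ws cs} (p : Walk G X s (tl G e)) → e ∈ˢ X → e ∉ edges (routing ws p cs) →
           Toggled (routing ws p cs) e (hd G e)
  extend {e} {ws} {cs} p e∈X e∉σ = routing ws (p ++ʷ cons e e∈X nil) cs , refl , added e∉σ (begin
    walkEdges G (p ++ʷ cons e e∈X nil) ++ C ++ W ≡⟨ cong (_++ C ++ W) (walkEdges-++ʷ p _) ⟩
    (P ++ [ e ]) ++ C ++ W                       ↭⟨ solve 4 (λ p e c w → (p ⊕ e) ⊕ c ⊕ w ⊜ e ⊕ p ⊕ c ⊕ w)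
                                                       ↭-refl P [ e ] C W ⟩
    e ∷ P ++ C ++ W                              ∎)
    where
    P C W : List (Fin m)
    P = walkEdges G p ; C = loopsEdges cs ; W = walksEdges ws

  reroute : ∀ {e} ws (p : Walk G X s (hd G e)) cs → e ∈ walksEdges ws →
            Toggled (routing ws p cs) e (tl G e)
  reroute {e} ws p cs e∈ws with ∈-concatMap-split (walkEdges G) ws e∈ws
  ... | pre , post , w , refl , e∈w with split-at w e∈w
  ... | a , b , w≡aeb =
    routing (pre ++ (p ++ʷ b) ∷ post) a cs , trans (length-++ pre) (sym (length-++ pre)) , removed (begin
      e ∷ A ++ C ++ walksEdges (pre ++ (p ++ʷ b) ∷ post)
        ≡⟨ cong (λ z → e ∷ A ++ C ++ z)
             (trans (concatMap-++ _ pre _) (cong (λ z → Pre ++ z ++ Post) (walkEdges-++ʷ p b))) ⟩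
      e ∷ A ++ C ++ Pre ++ (P ++ B) ++ Post
        ↭⟨ solve 7 (λ e a c pre p b post →
                      e ⊕ a ⊕ c ⊕ pre ⊕ (p ⊕ b) ⊕ post ⊜ p ⊕ c ⊕ pre ⊕ (a ⊕ e ⊕ b) ⊕ post)
             ↭-refl [ e ] A C Pre P B Post ⟩
      P ++ C ++ Pre ++ (A ++ e ∷ B) ++ Post
        ≡⟨ cong (λ z → P ++ C ++ z) (trans (concatMap-++ _ pre _) (cong (λ z → Pre ++ z ++ Post) w≡aeb)) ⟨
      P ++ C ++ walksEdges (pre ++ w ∷ post) ∎)
    where
    A B P C Pre Post : List (Fin m)
    A = walkEdges G a ; B = walkEdges G b ; P = walkEdges G p ; C = loopsEdges cs
    Pre = walksEdges pre ; Post = walksEdges post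

  close-loop : ∀ {e} ws (p : Walk G X s (hd G e)) cs → e ∈ walkEdges G p →
               Toggled (routing ws p cs) e (tl G e)
  close-loop {e} ws p cs e∈p with split-at p e∈p
  ... | a , b , p≡aeb = routing ws a ((hd G e , b) ∷ cs) , refl , removed (begin
    e ∷ A ++ (B ++ C) ++ W ↭⟨ solve 5 (λ e a b c w → e ⊕ a ⊕ (b ⊕ c) ⊕ w ⊜ (a ⊕ e ⊕ b) ⊕ c ⊕ w)
                                 ↭-refl [ e ] A B C W ⟩
    (A ++ e ∷ B) ++ C ++ W ≡⟨ cong (_++ C ++ W) p≡aeb ⟨
    walkEdges G p ++ C ++ W ∎)
    where
    A B C W : List (Fin m)
    A = walkEdges G a ; B = walkEdges G b ; C = loopsEdges cs ; W = walksEdges ws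

  splice-loop : ∀ {e} ws (p : Walk G X s (hd G e)) cs → e ∈ loopsEdges cs →
                Toggled (routing ws p cs) e (tl G e)
  splice-loop {e} ws p cs e∈cs with ∈-concatMap-split (walkEdges G ∘ proj₂) cs e∈cs
  ... | pre , post , (y , c) , refl , e∈c with split-at c e∈c
  ... | a , b , c≡aeb = routing ws (p ++ʷ b ++ʷ a) (pre ++ post) , refl , removed (begin
    e ∷ walkEdges G (p ++ʷ b ++ʷ a) ++ loopsEdges (pre ++ post) ++ W
      ≡⟨ cong₂ (λ z z′ → e ∷ z ++ z′ ++ W)
           (trans (walkEdges-++ʷ p _) (cong (P ++_) (walkEdges-++ʷ b a))) (concatMap-++ _ pre post) ⟩
    e ∷ (P ++ B ++ A) ++ (Pre ++ Post) ++ W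
      ↭⟨ solve 7 (λ e p b a pre post w →
                    e ⊕ (p ⊕ b ⊕ a) ⊕ (pre ⊕ post) ⊕ w ⊜ p ⊕ (pre ⊕ (a ⊕ e ⊕ b) ⊕ post) ⊕ w)
           ↭-refl [ e ] P B A Pre Post W ⟩
    P ++ (Pre ++ (A ++ e ∷ B) ++ Post) ++ W
      ≡⟨ cong (λ z → P ++ z ++ W) (trans (concatMap-++ _ pre _) (cong (λ z → Pre ++ z ++ Post) c≡aeb)) ⟨
    P ++ loopsEdges (pre ++ (y , c) ∷ post) ++ W ∎)
    where
    A B P W Pre Post : List (Fin m)
    A = walkEdges G a ; B = walkEdges G b ; P = walkEdges G p ; W = walksEdges ws
    Pre = loopsEdges pre ; Post = loopsEdges post

  advance : ∀ {F x y} (σ : Routing x) (st : ResStep F x y) →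
            edgeOf st ∈ edges σ ⇔ edgeOf st ∈ F → Toggled σ (edgeOf st) y
  advance (routing ws p cs) (forward e e∈X e∉F) agree =
    extend {ws = ws} {cs} p e∈X (e∉F ∘ Equivalence.to agree)
  advance (routing ws p cs) (backward e e∈F)    agree with Equivalence.from agree e∈F
  ... | e∈σ with ∈-++⁻ (walkEdges G p) e∈σ
  ... | inj₁ e∈p = close-loop ws p cs e∈p
  ... | inj₂ e∈cs,ws with ∈-++⁻ (loopsEdges cs) e∈cs,ws
  ... | inj₁ e∈cs = splice-loop ws p cs e∈cs
  ... | inj₂ e∈ws = reroute ws p cs e∈ws

  -- q is residual for the initial edge set F; since q repeats no edge, toggling its first
  -- edge keeps the current edges in agreement with F on the rest of q.
  augment : ∀ {F x} (q : Star (ResStep F) x t) → Unique (resEdges q) →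
            (σ : Routing x) → Unique (edges σ) → (∀ {f} → f ∈ resEdges q → f ∈ edges σ ⇔ f ∈ F) →
            ∃ λ (ws : List (Walk G X s t)) → length ws ≡ suc (length (routes σ)) × Unique (walksEdges ws)
  augment ε _ (routing ws p cs) unique _ =
    p ∷ ws , refl , Unique-++⁻ˡ (P ++ W) (Unique-resp-↭
      (solve 3 (λ p c w → p ⊕ c ⊕ w ⊜ (p ⊕ w) ⊕ c) ↭-refl P (loopsEdges cs) W) unique)
    where
    P W : List (Fin m)
    P = walkEdges G p ; W = walksEdges ws
  augment {F} (st ◅ q) (e∉q ∷ q-unique) σ unique agree with advance σ st (agree (here refl))
  ... | σ′ , same-length , toggle =
    let ws , length≡ , ws-unique = augment q q-unique σ′ (Toggle-unique toggle unique) agree′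
    in ws , trans length≡ (cong suc same-length) , ws-unique
    where
    agree′ : ∀ {f} → f ∈ resEdges q → f ∈ edges σ′ ⇔ f ∈ F
    agree′ f∈q = ⇔.trans (⇔.sym (Toggle-∈ toggle (≢-sym (All.lookup e∉q f∈q)))) (agree (there f∈q))

  routes-or-cut : ∀ j → (∃ λ (ws : List (Walk G X s t)) → length ws ≡ j × Unique (walksEdges ws)) ⊎
                        (∃ λ S → IsCut G s t S × ∣ δ⁺ G X S ∣ < j)
  routes-or-cut zero = inj₁ ([] , refl , [])
  routes-or-cut (suc j) with routes-or-cut j
  ... | inj₂ (S , cut , small) = inj₂ (S , cut , m<n⇒m<1+n small)
  ... | inj₁ (ws , refl , unique) with simple-walk-or-closed (resStep? (walksEdges ws)) s t
  ... | inj₁ (q , simple) =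
    inj₁ (augment q (simple⇒edge-unique q simple) (routing ws nil []) unique λ _ → ⇔.refl)
  ... | inj₂ (S , s∈S , t∉S , closed) = inj₂ (S , (s∈S , t∉S) , s≤s (cut-bound ws closed))

  flow-or-cut : ∀ j → HasFlow G X s t j ⊎ (∃ λ S → IsCut G s t S × ∣ δ⁺ G X S ∣ < j)
  flow-or-cut j with routes-or-cut j
  ... | inj₁ (ws , refl , unique) = inj₁ (walks⇒flow ws unique)
  ... | inj₂ cut                  = inj₂ cut

module _ {n m : ℕ} (G : Graph n m) where

  IsLamK-sym : ∀ {X k s t c} → IsLamK G X k s t c → IsLamK G X k t s c
  IsLamK-sym (c≤k , st-flow , ts-flow , maximal) =
    c≤k , ts-flow , st-flow , λ j j≤k ts-flowʲ st-flowʲ → maximal j j≤k st-flowʲ ts-flowʲ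

  symmetric-cut? : ∀ s t S → Dec (IsCut G s t S ⊎ IsCut G t s S)
  symmetric-cut? s t S = ((s ∈? S) ×-dec ¬? (t ∈? S)) ⊎-dec ((t ∈? S) ×-dec ¬? (s ∈? S))

  minimal-symmetric-cut : ∀ {s t S} → IsCut G s t S →
    ∃ λ S′ → (IsMinSymCut G ⊤ s t S′ ⊎ IsMinSymCut G ⊤ t s S′) × δ⁺ G ⊤ S′ ⊆ δ⁺ G ⊤ S
  minimal-symmetric-cut {s} {t} cut with minimal-below (symmetric-cut? s t) (δ⁺ G ⊤) (inj₁ cut)
  ... | S′ , inj₁ st-cut , below , minimal = S′ , inj₁ (st-cut , minimal) , below
  ... | S′ , inj₂ ts-cut , below , minimal =
    S′ , inj₂ (ts-cut , λ S″ smaller → minimal S″ smaller ∘ Sum.swap) , below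

  CutCondition : ℕ → Subset m → Set
  CutCondition k H = ∀ (s t : Fin n) (S : Subset n) → IsMinSymCut G ⊤ s t S →
                     ∀ (c : ℕ) → IsLamK G ⊤ k s t c → c ≤ ∣ δ⁺ G H S ∣

  CutCondition⇒flow : ∀ {k H} → CutCondition k H → ∀ {s t c} → IsLamK G ⊤ k s t c → HasFlow G H s t c
  CutCondition⇒flow {H = H} condition {s} {t} {c} lam with Menger.flow-or-cut G H s t c
  ... | inj₁ flow = flow
  ... | inj₂ (S , cut , small) with minimal-symmetric-cut cut
  ... | S′ , minimal , below = contradiction (large minimal) (<⇒≱ small′)
    where
    small′ : ∣ δ⁺ G H S′ ∣ < c
    small′ = ≤-<-trans (p⊆q⇒∣p∣≤∣q∣ (δ⁺-restrict G {Y = H} {S} {S′} (λ _ → ∈⊤) below)) small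
    large : IsMinSymCut G ⊤ s t S′ ⊎ IsMinSymCut G ⊤ t s S′ → c ≤ ∣ δ⁺ G H S′ ∣
    large (inj₁ st-minimal) = condition s t S′ st-minimal c lam
    large (inj₂ ts-minimal) = condition t s S′ ts-minimal c (IsLamK-sym lam)

theoremA8 : ∀ {n m : ℕ} (G : Graph n m) (k : ℕ) → 1 ≤ k → (H : Subset m) →
    ((∀ (s t : Fin n) (c : ℕ) → IsLamK G ⊤ k s t c → IsLamK G H k s t c) ⇔
    (∀ (s t : Fin n) (S : Subset n) → IsMinSymCut G ⊤ s t S →
    ∀ (c : ℕ) → IsLamK G ⊤ k s t c → c ≤ ∣ δ⁺ G H S ∣))
theoremA8 G k _ H = mk⇔ preserver⇒condition condition⇒preserver
  where
  open Walks G
  preserver⇒condition : (∀ s t c → IsLamK G ⊤ k s t c → IsLamK G H k s t c) → CutCondition G k H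
  preserver⇒condition preserves s t S (cut , _) c lam = flow≤cut (proj₁ (proj₂ (preserves s t c lam))) cut
  condition⇒preserver : CutCondition G k H → ∀ s t c → IsLamK G ⊤ k s t c → IsLamK G H k s t c
  condition⇒preserver condition s t c lam@(c≤k , _ , _ , maximal) =
    c≤k , CutCondition⇒flow G condition lam , CutCondition⇒flow G condition (IsLamK-sym G lam) ,
    λ j j≤k st-flow ts-flow →
      maximal j j≤k (HasFlow-mono (λ _ → ∈⊤) st-flow) (HasFlow-mono (λ _ → ∈⊤) ts-flow)
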